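{- Let $G$ be a graph with $n\ge 1$ vertices, and let $H$ be a graph with $p$ vertices, $q$ edges and independence number $\alpha(H)=2$. Let $\alpha=\alpha(G\circ H)$ and write $I(G\circ H;x)=\sum_{k=0}^{\alpha}s_kx^k$. Then: (i) $I(G\circ H;x)$ is $f$-symmetric, where $f(i)=\left(\frac{p(p-1)}{2}-q\right)^{\frac{\alpha}{2}-i}$ for $0\le i\le \alpha$; that is, $s_{\alpha-i}=\left(\frac{p(p-1)}{2}-q\right)^{\frac{\alpha}{2}-i}s_i$ for all $i\in\{0,1,\dots,\lfloor\alpha/2\rfloor\}$. (ii) $I(G\circ H;x)$ is symmetric if and only if $H$ is isomorphic to $K_r-e$ for some $r\ge 2$, where $K_r-e$ denotes the complete graph $K_r$ with one edge removed.
   Context: All graphs are finite, simple, with nonempty vertex set. An independent set of a graph is a set of pairwise non-adjacent vertices; $\alpha(G)$ is the maximum size of an independent set of $G$. If $s_k$ is the number of independent sets of size $k$ in $G$, the independence polynomial is $I(G;x)=\sum_{k=0}^{\alpha(G)}s_kx^k$. The corona $G\circ H$ is the graph obtained from $G$ and $|V(G)|$ disjoint copies of $H$, one copy for each vertex of $G$, by joining each vertex of $G$ to all vertices of its copy of $H$. A polynomial $\sum_{k=0}^{N}a_kx^k$ of degree $N$ is $f$-symmetric if $a_{N-i}=f(i)\,a_i$ for all $i\in\{0,\dots,\lfloor N/2\rfloor\}$, and symmetric if $a_{N-i}=a_i$ for all such $i$. -}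

module Defs where

open import Data.Nat using (ℕ; zero; suc; _+_; _*_; _∸_; _≡ᵇ_; _<ᵇ_; _⊔_)
open import Data.Bool using (Bool; true; false; not; _∧_; _∨_; if_then_else_)
open import Data.Bool.Properties using (∨-comm)
open import Data.Fin using (Fin; toℕ; splitAt; remQuot)
open import Data.Fin.Properties using (_≟_)
open import Data.Vec using (Vec; []; _∷_; lookup)
open import Data.List using (List; []; _∷_; _++_; map; filter; length; allFin; foldr)
open import Data.Bool.ListAction using (and)
open import Data.Nat.ListAction using (sum)
open import Data.Product using (_×_; _,_; proj₁; proj₂)
open import Data.Sum using (_⊎_; inj₁; inj₂)
open import Relation.Nullary using (yes; no; does)
open import Relation.Binary.PropositionalEquality using (_≡_; refl; sym; cong; cong₂)

record Graph (n : ℕ) : Set where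
  field
    adj    : Fin n → Fin n → Bool
    adjSym : ∀ i j → adj i j ≡ adj j i
    adjIrr : ∀ i → adj i i ≡ false
open Graph public

eqF : ∀ {n} → Fin n → Fin n → Bool
eqF i j = does (i ≟ j)

eqF-sym : ∀ {n} (i j : Fin n) → eqF i j ≡ eqF j i
eqF-sym i j with i ≟ j | j ≟ i
... | yes _ | yes _ = refl
... | no _  | no _  = refl
... | yes p | no q  with q (sym p)
... | ()
eqF-sym i j | no q | yes p with q (sym p)
... | ()

eqF-refl : ∀ {n} (i : Fin n) → eqF i i ≡ true
eqF-refl i with i ≟ i
... | yes _ = refl
... | no q with q refl
... | ()

allSubsets : (n : ℕ) → List (Vec Bool n)
allSubsets zero    = [] ∷ []
allSubsets (suc n) = map (true ∷_) (allSubsets n) ++ map (false ∷_) (allSubsets n)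

size : ∀ {n} → Vec Bool n → ℕ
size []            = 0
size (true  ∷ xs) = suc (size xs)
size (false ∷ xs) = size xs

isIndependent : ∀ {n} → Graph n → Vec Bool n → Bool
isIndependent {n} G S =
  and (map (λ i → and (map (λ j → not (lookup S i ∧ lookup S j ∧ adj G i j)) (allFin n))) (allFin n))

independentSets : ∀ {n} → Graph n → List (Vec Bool n)
independentSets {n} G = filter (λ S → isIndependent G S ≡ᵇ' true) (allSubsets n)
  where
  open import Data.Bool.Properties using () renaming (_≟_ to _≡ᵇ'_)

indepCount : ∀ {n} → Graph n → ℕ → ℕ
indepCount G k = length (filter (λ S → size S Data.Nat.≟ k) (independentSets G))

indepNumber : ∀ {n} → Graph n → ℕ
indepNumber G = foldr _⊔_ 0 (map size (independentSets G))

edgeCount : ∀ {n} → Graph n → ℕ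
edgeCount {n} G =
  sum (map (λ i → sum (map (λ j → if (toℕ i <ᵇ toℕ j) ∧ adj G i j then 1 else 0) (allFin n))) (allFin n))

-- Vertex set Fin (n + n * p): the first n vertices are those of G;
-- a vertex k of the second block with remQuot p k = (c , h) is vertex h of the
-- c-th copy of H (which is attached to vertex c of G).
copyOf : ∀ n p → Fin (n * p) → Fin n
copyOf n p k = proj₁ (remQuot {n} p k)

posOf : ∀ n p → Fin (n * p) → Fin p
posOf n p k = proj₂ (remQuot {n} p k)

coronaAdj : ∀ {n p} → Graph n → Graph p → Fin n ⊎ Fin (n * p) → Fin n ⊎ Fin (n * p) → Bool
coronaAdj G H (inj₁ i) (inj₁ j) = adj G i j
coronaAdj {n} {p} G H (inj₁ i) (inj₂ k) = eqF i (copyOf n p k)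
coronaAdj {n} {p} G H (inj₂ k) (inj₁ j) = eqF (copyOf n p k) j
coronaAdj {n} {p} G H (inj₂ k) (inj₂ l) =
  eqF (copyOf n p k) (copyOf n p l) ∧ adj H (posOf n p k) (posOf n p l)

coronaAdj-sym : ∀ {n p} (G : Graph n) (H : Graph p) x y → coronaAdj G H x y ≡ coronaAdj G H y x
coronaAdj-sym G H (inj₁ i) (inj₁ j) = adjSym G i j
coronaAdj-sym {n} {p} G H (inj₁ i) (inj₂ k) = eqF-sym i (copyOf n p k)
coronaAdj-sym {n} {p} G H (inj₂ k) (inj₁ j) = eqF-sym (copyOf n p k) j
coronaAdj-sym {n} {p} G H (inj₂ k) (inj₂ l) =
  cong₂ _∧_ (eqF-sym (copyOf n p k) (copyOf n p l)) (adjSym H (posOf n p k) (posOf n p l))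

coronaAdj-irr : ∀ {n p} (G : Graph n) (H : Graph p) x → coronaAdj G H x x ≡ false
coronaAdj-irr G H (inj₁ i) = adjIrr G i
coronaAdj-irr {n} {p} G H (inj₂ k) =
  cong₂ _∧_ (eqF-refl (copyOf n p k)) (adjIrr H (posOf n p k))

corona : ∀ {n p} → Graph n → Graph p → Graph (n + n * p)
corona {n} G H = record
  { adj    = λ u v → coronaAdj G H (splitAt n u) (splitAt n v)
  ; adjSym = λ u v → coronaAdj-sym G H (splitAt n u) (splitAt n v)
  ; adjIrr = λ u → coronaAdj-irr G H (splitAt n u)
  }

-- K_r - e for r = m + 2: complete graph on Fin (2+m) with the edge {0,1} removed
KminusE : (m : ℕ) → Graph (suc (suc m))
KminusE m = record { adj = a ; adjSym = s ; adjIrr = ir }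
  where
  z o : Fin (suc (suc m))
  z = Fin.zero
  o = Fin.suc Fin.zero
  e : Fin (suc (suc m)) → Fin (suc (suc m)) → Bool
  e i j = eqF i j ∨ (eqF i z ∧ eqF j o)
  a : Fin (suc (suc m)) → Fin (suc (suc m)) → Bool
  a i j = not (e i j ∨ e j i)
  s : ∀ i j → a i j ≡ a j i
  s i j = cong not (∨-comm (e i j) (e j i))
  ir : ∀ i → a i i ≡ false
  ir i rewrite eqF-refl i = refl

record _≅_ {n m : ℕ} (G : Graph n) (H : Graph m) : Set where
  field
    to      : Fin n → Fin m
    from    : Fin m → Fin n
    from∘to : ∀ i → from (to i) ≡ i
    to∘from : ∀ j → to (from j) ≡ j
    preserves : ∀ i j → adj G i j ≡ adj H (to i) (to j)

fSymmetric : (a : ℕ → ℕ) (N : ℕ) (f : ℕ → ℕ) → Set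
fSymmetric a N f = ∀ i → i Data.Nat.≤ N Data.Nat./ 2 → a (N ∸ i) ≡ f i * a i

Symmetric : (a : ℕ → ℕ) (N : ℕ) → Set
Symmetric a N = ∀ i → i Data.Nat.≤ N Data.Nat./ 2 → a (N ∸ i) ≡ a i

-- An independent set of G ∘ H consists of an independent set A of G together with, for every vertex
-- of G outside A, an independent set of the copy of H attached to it (the copies at vertices of A stay
-- empty). Hence I(G ∘ H; x) = Σ_A x^|A| I(H; x)^(n - |A|), and α(H) = 2 makes I(H; x) = 1 + p x + t x²
-- with t = p(p-1)/2 - q the number of non-edges of H. Each summand x^a (1 + p x + t x²)^z, a + z = n,
-- has coefficients with c(n + d) = t^d c(n - d), hence so does the sum: s(2n - i) = t^(n-i) s(i).
-- In particular s(2n) = t^n ≠ 0 is the top coefficient, so α(G ∘ H) = 2n, and the polynomial is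
-- symmetric iff t = 1, i.e. iff H has exactly one non-edge, i.e. iff H ≅ K_r - e.

module Submission where

open import Defs
open import Data.Nat using (ℕ; zero; suc; _+_; _*_; _∸_; _^_; _/_; _≤_; _<_; z≤n; s≤s; _≡ᵇ_; _<ᵇ_; _⊔_; _≤?_)
open import Data.Nat.Properties
open import Data.Nat.DivMod using (m*n/n≡m)
open import Data.Nat.ListAction using (sum)
open import Data.Nat.ListAction.Properties using (sum-++)
open import Data.Nat.Tactic.RingSolver using (solve-∀)
open import Data.Bool using (Bool; true; false; not; _∧_; _∨_; if_then_else_; T)
import Data.Bool.Properties as 𝔹
open import Data.Bool.ListAction using (all)
open import Data.Fin using (Fin; zero; suc; toℕ; splitAt; join; combine)
import Data.Fin.Properties as Fin
open import Data.Fin.Properties using (splitAt-join; remQuot-combine; combine-remQuot)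
open import Data.Fin.Subset using (⁅_⁆; ∁) renaming (⊥ to ∅)
open import Data.Fin.Subset.Properties using (x∈⁅y⁆⇒x≡y)
open import Data.Fin.Permutation using (Permutation′; _⟨$⟩ʳ_; _⟨$⟩ˡ_; inverseˡ; inverseʳ; transpose; _∘ₚ_)
import Data.Fin.Permutation.Components as Components
open import Data.Vec using (Vec; []; _∷_; lookup; _++_; concat)
open import Data.Vec.Properties using (lookup-replicate; lookup⇒[]=; lookup-splitAt; lookup-concat)
open import Data.List using (List; []; _∷_; map; filter; length; allFin; foldr)
import Data.List as List
import Data.List.Properties as ListP
import Data.List.Relation.Unary.All as All
open import Data.List.Relation.Unary.All.Properties using (all⁺; all⁻; tabulate⁺)
open import Data.List.Relation.Unary.Any using (here; there)
open import Data.List.Membership.Propositional using (_∈_)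
open import Data.List.Membership.Propositional.Properties
  using (∈-allFin; ∈-map⁺; ∈-map⁻; ∈-++⁺ˡ; ∈-++⁺ʳ; ∈-filter⁺; ∈-filter⁻; ∈-length)
open import Data.Product using (_×_; _,_; proj₁; proj₂; Σ; ∃-syntax; ∃₂)
open import Data.Sum using (_⊎_; inj₁; inj₂; [_,_]′)
open import Data.Empty using (⊥-elim)
open import Function using (_∘_; _⇔_; mk⇔; Equivalence)
open import Function.Construct.Composition using (_⇔-∘_)
open import Relation.Nullary using (¬_; yes; no; does)
open import Relation.Nullary.Decidable using (dec-true; dec-false)
open import Relation.Unary using (Decidable)
open import Relation.Binary.Definitions using (tri<; tri≈; tri>)
open import Relation.Binary.PropositionalEquality
  using (_≡_; _≢_; refl; sym; trans; cong; cong₂; subst; subst₂; module ≡-Reasoning)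
open import Algebra.Properties.Semiring.Sum +-*-semiring using (sum-syntax; sum-cong-≗; ∑-distrib-+)
open import Algebra.Properties.CommutativeSemigroup +-commutativeSemigroup using (interchange)
open ≡-Reasoning

𝟙 : Bool → ℕ
𝟙 b = if b then 1 else 0

𝟙-∧ : ∀ x y → 𝟙 (x ∧ y) ≡ 𝟙 x * 𝟙 y
𝟙-∧ false y = refl
𝟙-∧ true  y = sym (+-identityʳ (𝟙 y))

T⇔T⇒≡ : ∀ {x y} → T x ⇔ T y → x ≡ y
T⇔T⇒≡ {false} {false} _ = refl
T⇔T⇒≡ {false} {true}  e = ⊥-elim (Equivalence.from e _)
T⇔T⇒≡ {true}  {false} e = ⊥-elim (Equivalence.to e _)
T⇔T⇒≡ {true}  {true}  _ = refl

-- Sums over subsets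

∑ₛ : (N : ℕ) → (Vec Bool N → ℕ) → ℕ
∑ₛ zero    w = w []
∑ₛ (suc N) w = ∑ₛ N (λ S → w (true ∷ S)) + ∑ₛ N (λ S → w (false ∷ S))

sum-allSubsets : ∀ N (w : Vec Bool N → ℕ) → sum (map w (allSubsets N)) ≡ ∑ₛ N w
sum-allSubsets zero    w = +-identityʳ (w [])
sum-allSubsets (suc N) w = begin
  sum (map w (map (true ∷_) L List.++ map (false ∷_) L))
    ≡⟨ cong sum (ListP.map-++ w (map (true ∷_) L) _) ⟩
  sum (map w (map (true ∷_) L) List.++ map w (map (false ∷_) L))
    ≡⟨ sum-++ (map w (map (true ∷_) L)) _ ⟩
  sum (map w (map (true ∷_) L)) + sum (map w (map (false ∷_) L))
    ≡⟨ cong₂ _+_ (cong sum (sym (ListP.map-∘ L))) (cong sum (sym (ListP.map-∘ L))) ⟩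
  sum (map (w ∘ (true ∷_)) L) + sum (map (w ∘ (false ∷_)) L)
    ≡⟨ cong₂ _+_ (sum-allSubsets N _) (sum-allSubsets N _) ⟩
  ∑ₛ (suc N) w ∎
  where
  L : List (Vec Bool N)
  L = allSubsets N

∑ₛ-cong : ∀ N {v w : Vec Bool N → ℕ} → (∀ S → v S ≡ w S) → ∑ₛ N v ≡ ∑ₛ N w
∑ₛ-cong zero    e = e []
∑ₛ-cong (suc N) e = cong₂ _+_ (∑ₛ-cong N (e ∘ (true ∷_))) (∑ₛ-cong N (e ∘ (false ∷_)))

∑ₛ-zero : ∀ N {w : Vec Bool N → ℕ} → (∀ S → w S ≡ 0) → ∑ₛ N w ≡ 0
∑ₛ-zero zero    e = e []
∑ₛ-zero (suc N) e = cong₂ _+_ (∑ₛ-zero N (e ∘ (true ∷_))) (∑ₛ-zero N (e ∘ (false ∷_)))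

∑ₛ-distrib-+ : ∀ N (v w : Vec Bool N → ℕ) → ∑ₛ N (λ S → v S + w S) ≡ ∑ₛ N v + ∑ₛ N w
∑ₛ-distrib-+ zero    v w = refl
∑ₛ-distrib-+ (suc N) v w = trans
  (cong₂ _+_ (∑ₛ-distrib-+ N _ _) (∑ₛ-distrib-+ N _ _))
  (interchange (∑ₛ N (v ∘ (true ∷_))) _ _ _)

∑ₛ-*ˡ : ∀ N c (w : Vec Bool N → ℕ) → ∑ₛ N (λ S → c * w S) ≡ c * ∑ₛ N w
∑ₛ-*ˡ zero    c w = refl
∑ₛ-*ˡ (suc N) c w = trans (cong₂ _+_ (∑ₛ-*ˡ N c _) (∑ₛ-*ˡ N c _)) (sym (*-distribˡ-+ c _ _))

∑ₛ-*ʳ : ∀ N c (w : Vec Bool N → ℕ) → ∑ₛ N (λ S → w S * c) ≡ ∑ₛ N w * c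
∑ₛ-*ʳ N c w = begin
  ∑ₛ N (λ S → w S * c) ≡⟨ ∑ₛ-cong N (λ S → *-comm (w S) c) ⟩
  ∑ₛ N (λ S → c * w S) ≡⟨ ∑ₛ-*ˡ N c w ⟩
  c * ∑ₛ N w           ≡⟨ *-comm c _ ⟩
  ∑ₛ N w * c           ∎

∑ₛ-++ : ∀ a b (w : Vec Bool (a + b) → ℕ) → ∑ₛ (a + b) w ≡ ∑ₛ a (λ S → ∑ₛ b (λ U → w (S ++ U)))
∑ₛ-++ zero    b w = refl
∑ₛ-++ (suc a) b w = cong₂ _+_ (∑ₛ-++ a b _) (∑ₛ-++ a b _)

∑ₛ-empty : ∀ N (w : Vec Bool N → ℕ) → ∑ₛ N (λ S → 𝟙 (size S ≡ᵇ 0) * w S) ≡ w ∅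
∑ₛ-empty zero    w = +-identityʳ (w [])
∑ₛ-empty (suc N) w = cong₂ _+_ (∑ₛ-zero N (λ _ → refl)) (∑ₛ-empty N _)

∑ₛ-singletons : ∀ N (w : Vec Bool N → ℕ) → ∑ₛ N (λ S → 𝟙 (size S ≡ᵇ 1) * w S) ≡ ∑[ j < N ] w ⁅ j ⁆
∑ₛ-singletons zero    w = refl
∑ₛ-singletons (suc N) w = cong₂ _+_ (∑ₛ-empty N _) (∑ₛ-singletons N _)

-- Counting independent sets

length-filter-filter : ∀ {A : Set} {P Q : A → Set} (P? : Decidable P) (Q? : Decidable Q) xs →
  length (filter P? (filter Q? xs)) ≡ sum (map (λ x → 𝟙 (does (Q? x)) * 𝟙 (does (P? x))) xs)
length-filter-filter P? Q? [] = refl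
length-filter-filter P? Q? (x ∷ xs) with does (Q? x)
... | false = length-filter-filter P? Q? xs
... | true with does (P? x)
...   | true  = cong suc (length-filter-filter P? Q? xs)
...   | false = length-filter-filter P? Q? xs

does-≟true : ∀ b → does (b 𝔹.≟ true) ≡ b
does-≟true false = refl
does-≟true true  = refl

indepCount-∑ₛ : ∀ {N} (G : Graph N) k →
  indepCount G k ≡ ∑ₛ N (λ S → 𝟙 (isIndependent G S) * 𝟙 (size S ≡ᵇ k))
indepCount-∑ₛ {N} G k = begin
  indepCount G k
    ≡⟨ length-filter-filter _ _ (allSubsets N) ⟩
  sum (map (λ S → 𝟙 (does (isIndependent G S 𝔹.≟ true)) * 𝟙 (size S ≡ᵇ k)) (allSubsets N))
    ≡⟨ cong sum (ListP.map-cong (λ S → cong (λ b → 𝟙 b * 𝟙 (size S ≡ᵇ k)) (does-≟true (isIndependent G S)))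
                                (allSubsets N)) ⟩
  sum (map (λ S → 𝟙 (isIndependent G S) * 𝟙 (size S ≡ᵇ k)) (allSubsets N))
    ≡⟨ sum-allSubsets N _ ⟩
  ∑ₛ N (λ S → 𝟙 (isIndependent G S) * 𝟙 (size S ≡ᵇ k)) ∎

Independent : ∀ {N} → Graph N → Vec Bool N → Set
Independent G S = ∀ i j → T (lookup S i) → T (lookup S j) → adj G i j ≡ false

module _ {N} (G : Graph N) (S : Vec Bool N) where
  private
    no-edge⇒ : ∀ x y z → T (not (x ∧ y ∧ z)) → T x → T y → z ≡ false
    no-edge⇒ true true false _ _ _ = refl
    no-edge⇐ : ∀ x y z → (T x → T y → z ≡ false) → T (not (x ∧ y ∧ z))
    no-edge⇐ false y     z h = _
    no-edge⇐ true  false z h = _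
    no-edge⇐ true  true  z h with z | h _ _
    ... | false | _ = _
    all⇒ : ∀ (f : Fin N → Bool) → T (all f (allFin N)) → ∀ i → T (f i)
    all⇒ f t i = All.lookup (all⁺ f (allFin N) t) (∈-allFin i)
    all⇐ : ∀ (f : Fin N → Bool) → (∀ i → T (f i)) → T (all f (allFin N))
    all⇐ f h = all⁻ f (tabulate⁺ h)

  isIndependent⇒ : T (isIndependent G S) → Independent G S
  isIndependent⇒ t i j = no-edge⇒ _ _ _ (all⇒ _ (all⇒ _ t i) j)

  isIndependent⇐ : Independent G S → T (isIndependent G S)
  isIndependent⇐ h = all⇐ _ (λ i → all⇐ _ (λ j → no-edge⇐ _ _ _ (h i j)))

isIndependent-cong : ∀ {M N} (G : Graph M) (H : Graph N) S U →
  (Independent G S → Independent H U) → (Independent H U → Independent G S) →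
  isIndependent G S ≡ isIndependent H U
isIndependent-cong G H S U f g = T⇔T⇒≡ (mk⇔
  (isIndependent⇐ H U ∘ f ∘ isIndependent⇒ G S) (isIndependent⇐ G S ∘ g ∘ isIndependent⇒ H U))

∉∅ : ∀ {N} (i : Fin N) → ¬ T (lookup ∅ i)
∉∅ i = subst T (lookup-replicate i false)

∈⁅⁆⇒≡ : ∀ {N} (j k : Fin N) → T (lookup ⁅ j ⁆ k) → k ≡ j
∈⁅⁆⇒≡ j k t = x∈⁅y⁆⇒x≡y j (lookup⇒[]= k ⁅ j ⁆ (Equivalence.to 𝔹.T-≡ t))

∈⁅⁆ : ∀ {N} (j : Fin N) → T (lookup ⁅ j ⁆ j)
∈⁅⁆ zero    = _
∈⁅⁆ (suc j) = ∈⁅⁆ j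

∅-independent : ∀ {N} (G : Graph N) → isIndependent G ∅ ≡ true
∅-independent G = Equivalence.to 𝔹.T-≡ (isIndependent⇐ G ∅ (λ i _ i∈∅ _ → ⊥-elim (∉∅ i i∈∅)))

⁅⁆-independent : ∀ {N} (G : Graph N) j → isIndependent G ⁅ j ⁆ ≡ true
⁅⁆-independent G j = Equivalence.to 𝔹.T-≡ (isIndependent⇐ G ⁅ j ⁆ loopless)
  where
  loopless : Independent G ⁅ j ⁆
  loopless i k i∈ k∈ rewrite ∈⁅⁆⇒≡ j i i∈ | ∈⁅⁆⇒≡ j k k∈ = adjIrr G j

removeFirst : ∀ {N} → Graph (suc N) → Graph N
removeFirst G = record
  { adj    = λ i j → adj G (suc i) (suc j)
  ; adjSym = λ i j → adjSym G (suc i) (suc j)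
  ; adjIrr = λ i → adjIrr G (suc i)
  }

isIndependent-∷false : ∀ {N} (G : Graph (suc N)) S →
  isIndependent G (false ∷ S) ≡ isIndependent (removeFirst G) S
isIndependent-∷false G S = isIndependent-cong G (removeFirst G) (false ∷ S) S
  (λ ind i j → ind (suc i) (suc j)) extend
  where
  extend : Independent (removeFirst G) S → Independent G (false ∷ S)
  extend ind (suc i) (suc j) = ind i j

isIndependent-pair : ∀ {N} (G : Graph (suc N)) j →
  isIndependent G (true ∷ ⁅ j ⁆) ≡ not (adj G zero (suc j))
isIndependent-pair G j = T⇔T⇒≡ (mk⇔
  (λ t → Equivalence.from 𝔹.T-not-≡ (isIndependent⇒ G (true ∷ ⁅ j ⁆) t zero (suc j) _ (∈⁅⁆ j)))
  (λ t → isIndependent⇐ G (true ∷ ⁅ j ⁆) (pair (Equivalence.to 𝔹.T-not-≡ t))))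
  where
  pair : adj G zero (suc j) ≡ false → Independent G (true ∷ ⁅ j ⁆)
  pair e zero    zero    _  _  = adjIrr G zero
  pair e zero    (suc k) _  k∈ rewrite ∈⁅⁆⇒≡ j k k∈ = e
  pair e (suc i) zero    i∈ _  rewrite ∈⁅⁆⇒≡ j i i∈ = trans (adjSym G _ _) e
  pair e (suc i) (suc k) i∈ k∈ rewrite ∈⁅⁆⇒≡ j i i∈ | ∈⁅⁆⇒≡ j k k∈ = adjIrr G (suc j)

∑-const-1 : ∀ N → ∑[ j < N ] 1 ≡ N
∑-const-1 zero    = refl
∑-const-1 (suc N) = cong suc (∑-const-1 N)

sum-map-allFin : ∀ N (f : Fin N → ℕ) → sum (map f (allFin N)) ≡ ∑[ i < N ] f i
sum-map-allFin N f = trans (cong sum (ListP.map-tabulate (λ i → i) f)) (sum-tabulate N f)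
  where
  sum-tabulate : ∀ N (f : Fin N → ℕ) → sum (List.tabulate f) ≡ ∑[ i < N ] f i
  sum-tabulate zero    f = refl
  sum-tabulate (suc N) f = cong (f zero +_) (sum-tabulate N (f ∘ suc))

indepCount-0 : ∀ {N} (G : Graph N) → indepCount G 0 ≡ 1
indepCount-0 {N} G = begin
  indepCount G 0                                        ≡⟨ indepCount-∑ₛ G 0 ⟩
  ∑ₛ N (λ S → 𝟙 (isIndependent G S) * 𝟙 (size S ≡ᵇ 0)) ≡⟨ ∑ₛ-cong N (λ S → *-comm (𝟙 (isIndependent G S)) _) ⟩
  ∑ₛ N (λ S → 𝟙 (size S ≡ᵇ 0) * 𝟙 (isIndependent G S)) ≡⟨ ∑ₛ-empty N _ ⟩
  𝟙 (isIndependent G ∅)                                 ≡⟨ cong 𝟙 (∅-independent G) ⟩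
  1                                                     ∎

indepCount-1 : ∀ {N} (G : Graph N) → indepCount G 1 ≡ N
indepCount-1 {N} G = begin
  indepCount G 1                                        ≡⟨ indepCount-∑ₛ G 1 ⟩
  ∑ₛ N (λ S → 𝟙 (isIndependent G S) * 𝟙 (size S ≡ᵇ 1)) ≡⟨ ∑ₛ-cong N (λ S → *-comm (𝟙 (isIndependent G S)) _) ⟩
  ∑ₛ N (λ S → 𝟙 (size S ≡ᵇ 1) * 𝟙 (isIndependent G S)) ≡⟨ ∑ₛ-singletons N _ ⟩
  ∑[ j < N ] 𝟙 (isIndependent G ⁅ j ⁆)                  ≡⟨ sum-cong-≗ (cong 𝟙 ∘ ⁅⁆-independent G) ⟩
  ∑[ j < N ] 1                                          ≡⟨ ∑-const-1 N ⟩
  N                                                     ∎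

nonEdgeCount : ∀ {N} → Graph N → ℕ
nonEdgeCount {N} G = ∑[ i < N ] ∑[ j < N ] 𝟙 ((toℕ i <ᵇ toℕ j) ∧ not (adj G i j))

indepCount-2 : ∀ {N} (G : Graph N) → indepCount G 2 ≡ nonEdgeCount G
indepCount-2 {N} G = trans (indepCount-∑ₛ G 2) (pairs N G)
  where
  pairs : ∀ N (G : Graph N) → ∑ₛ N (λ S → 𝟙 (isIndependent G S) * 𝟙 (size S ≡ᵇ 2)) ≡ nonEdgeCount G
  pairs zero    G = refl
  pairs (suc N) G = cong₂ _+_ containing0 avoiding0
    where
    containing0 : ∑ₛ N (λ S → 𝟙 (isIndependent G (true ∷ S)) * 𝟙 (size S ≡ᵇ 1))
                ≡ ∑[ j < N ] 𝟙 (not (adj G zero (suc j)))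
    containing0 = begin
      ∑ₛ N (λ S → 𝟙 (isIndependent G (true ∷ S)) * 𝟙 (size S ≡ᵇ 1))
        ≡⟨ ∑ₛ-cong N (λ S → *-comm (𝟙 (isIndependent G (true ∷ S))) _) ⟩
      ∑ₛ N (λ S → 𝟙 (size S ≡ᵇ 1) * 𝟙 (isIndependent G (true ∷ S)))
        ≡⟨ ∑ₛ-singletons N _ ⟩
      ∑[ j < N ] 𝟙 (isIndependent G (true ∷ ⁅ j ⁆))
        ≡⟨ sum-cong-≗ (cong 𝟙 ∘ isIndependent-pair G) ⟩
      ∑[ j < N ] 𝟙 (not (adj G zero (suc j))) ∎
    avoiding0 : ∑ₛ N (λ S → 𝟙 (isIndependent G (false ∷ S)) * 𝟙 (size S ≡ᵇ 2))
              ≡ nonEdgeCount (removeFirst G)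
    avoiding0 = trans
      (∑ₛ-cong N (λ S → cong (λ b → 𝟙 b * 𝟙 (size S ≡ᵇ 2)) (isIndependent-∷false G S)))
      (pairs N (removeFirst G))

pairCount : ℕ → ℕ
pairCount N = ∑[ i < N ] ∑[ j < N ] 𝟙 (toℕ i <ᵇ toℕ j)

pairCount-formula : ∀ N → N * (N ∸ 1) / 2 ≡ pairCount N
pairCount-formula N = trans (cong (_/ 2) (sym (double N))) (m*n/n≡m (pairCount N) 2)
  where
  double : ∀ N → pairCount N * 2 ≡ N * (N ∸ 1)
  double zero    = refl
  double (suc N) = begin
    (∑[ j < N ] 1 + pairCount N) * 2 ≡⟨ cong (λ m → (m + pairCount N) * 2) (∑-const-1 N) ⟩
    (N + pairCount N) * 2            ≡⟨ *-distribʳ-+ 2 N (pairCount N) ⟩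
    N * 2 + pairCount N * 2          ≡⟨ cong (N * 2 +_) (double N) ⟩
    N * 2 + N * (N ∸ 1)              ≡⟨ step N ⟩
    suc N * N                        ∎
    where
    step : ∀ N → N * 2 + N * (N ∸ 1) ≡ suc N * N
    step zero    = refl
    step (suc M) = identity M
      where
      identity : ∀ M → suc M * 2 + suc M * M ≡ suc (suc M) * suc M
      identity = solve-∀

edgeCount+nonEdgeCount : ∀ {N} (G : Graph N) → edgeCount G + nonEdgeCount G ≡ pairCount N
edgeCount+nonEdgeCount {N} G = begin
  edgeCount G + nonEdgeCount G
    ≡⟨ cong (_+ nonEdgeCount G)
            (trans (cong sum (ListP.map-cong (λ i → sum-map-allFin N _) (allFin N))) (sum-map-allFin N _)) ⟩
  ∑[ i < N ] ∑[ j < N ] 𝟙 ((toℕ i <ᵇ toℕ j) ∧ adj G i j) + nonEdgeCount G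
    ≡⟨ sym (∑-distrib-+ {N} _ _) ⟩
  ∑[ i < N ] (∑[ j < N ] 𝟙 ((toℕ i <ᵇ toℕ j) ∧ adj G i j) + ∑[ j < N ] 𝟙 ((toℕ i <ᵇ toℕ j) ∧ not (adj G i j)))
    ≡⟨ sum-cong-≗ (λ i → trans (sym (∑-distrib-+ {N} _ _))
                                (sum-cong-≗ (λ j → 𝟙-split (toℕ i <ᵇ toℕ j) (adj G i j)))) ⟩
  pairCount N ∎
  where
  𝟙-split : ∀ x y → 𝟙 (x ∧ y) + 𝟙 (x ∧ not y) ≡ 𝟙 x
  𝟙-split false y     = refl
  𝟙-split true  false = refl
  𝟙-split true  true  = refl

nonEdgeCount-formula : ∀ {N} (G : Graph N) → N * (N ∸ 1) / 2 ∸ edgeCount G ≡ nonEdgeCount G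
nonEdgeCount-formula {N} G = begin
  N * (N ∸ 1) / 2 ∸ edgeCount G                  ≡⟨ cong (_∸ edgeCount G) (pairCount-formula N) ⟩
  pairCount N ∸ edgeCount G                      ≡⟨ cong (_∸ edgeCount G) (sym (edgeCount+nonEdgeCount G)) ⟩
  edgeCount G + nonEdgeCount G ∸ edgeCount G     ≡⟨ m+n∸m≡n (edgeCount G) _ ⟩
  nonEdgeCount G                                 ∎

-- The independence number

∈-allSubsets : ∀ {N} (S : Vec Bool N) → S ∈ allSubsets N
∈-allSubsets []          = here refl
∈-allSubsets (true  ∷ S) = ∈-++⁺ˡ (∈-map⁺ (true ∷_) (∈-allSubsets S))
∈-allSubsets {suc N} (false ∷ S) = ∈-++⁺ʳ (map (true ∷_) (allSubsets N)) (∈-map⁺ (false ∷_) (∈-allSubsets S))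

≤-foldr-⊔ : ∀ {x xs} → x ∈ xs → x ≤ foldr _⊔_ 0 xs
≤-foldr-⊔ {xs = y ∷ ys} (here refl) = m≤m⊔n y _
≤-foldr-⊔ {xs = y ∷ ys} (there x∈) = ≤-trans (≤-foldr-⊔ x∈) (m≤n⊔m y _)

foldr-⊔-attained : ∀ xs → foldr _⊔_ 0 xs ≡ 0 ⊎ foldr _⊔_ 0 xs ∈ xs
foldr-⊔-attained []       = inj₁ refl
foldr-⊔-attained (y ∷ ys) with ⊔-sel y (foldr _⊔_ 0 ys) | foldr-⊔-attained ys
... | inj₁ y⊔≡y | _             = inj₂ (here y⊔≡y)
... | inj₂ y⊔≡m | inj₁ m≡0      = inj₁ (trans y⊔≡m m≡0)
... | inj₂ y⊔≡m | inj₂ m∈ys     = inj₂ (there (subst (_∈ ys) (sym y⊔≡m) m∈ys))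

module _ {N} (G : Graph N) where

  private
    independent? : Decidable (λ S → isIndependent G S ≡ true)
    independent? S = isIndependent G S 𝔹.≟ true

  size≤indepNumber : ∀ S → isIndependent G S ≡ true → size S ≤ indepNumber G
  size≤indepNumber S ind = ≤-foldr-⊔ (∈-map⁺ size (∈-filter⁺ independent? (∈-allSubsets S) ind))

  indepCount≢0 : ∀ S k → isIndependent G S ≡ true → size S ≡ k → indepCount G k ≢ 0
  indepCount≢0 S k ind refl = m<n⇒n≢0 (∈-length (∈-filter⁺ (λ U → size U ≟ size S)
    (∈-filter⁺ independent? (∈-allSubsets S) ind) refl))

  indepCount≢0⇒independent : ∀ k → indepCount G k ≢ 0 →
    ∃[ S ] isIndependent G S ≡ true × size S ≡ k
  indepCount≢0⇒independent k ≢0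
    with filter (λ U → size U ≟ k) (independentSets G) in eq
  ... | []    = ⊥-elim (≢0 refl)
  ... | S ∷ _ with ∈-filter⁻ (λ U → size U ≟ k) {xs = independentSets G} (subst (S ∈_) (sym eq) (here refl))
  ...   | S∈ , refl = S , proj₂ (∈-filter⁻ independent? {xs = allSubsets N} S∈) , refl

  indepCount≢0⇒≤indepNumber : ∀ k → indepCount G k ≢ 0 → k ≤ indepNumber G
  indepCount≢0⇒≤indepNumber k ≢0 with indepCount≢0⇒independent k ≢0
  ... | S , ind , refl = size≤indepNumber S ind

  indepCount-indepNumber≢0 : indepCount G (indepNumber G) ≢ 0
  indepCount-indepNumber≢0 with foldr-⊔-attained (map size (independentSets G))
  ... | inj₁ α≡0 = subst (λ k → indepCount G k ≢ 0) (sym α≡0) (λ c → 1+n≢0 (trans (sym (indepCount-0 G)) c))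
  ... | inj₂ α∈ with ∈-map⁻ size α∈
  ...   | S , S∈ , α≡ = indepCount≢0 S _ (proj₂ (∈-filter⁻ independent? {xs = allSubsets N} S∈)) (sym α≡)

  indepNumber-unique : ∀ m → indepCount G m ≢ 0 → (∀ k → m < k → indepCount G k ≡ 0) → indepNumber G ≡ m
  indepNumber-unique m ≢0 vanish = ≤-antisym
    (≮⇒≥ (λ m<α → indepCount-indepNumber≢0 (vanish _ m<α)))
    (indepCount≢0⇒≤indepNumber m ≢0)

-- Palindromic coefficient sequences

-- shift a g is the coefficient sequence of x^a · g
shift : ℕ → (ℕ → ℕ) → ℕ → ℕ
shift zero    g k       = g k
shift (suc a) g zero    = 0
shift (suc a) g (suc k) = shift a g k

shift-+ : ∀ a g k → shift a g (a + k) ≡ g k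
shift-+ zero    g k = refl
shift-+ (suc a) g k = shift-+ a g k

shift-< : ∀ a g k → k < a → shift a g k ≡ 0
shift-< (suc a) g zero    _         = refl
shift-< (suc a) g (suc k) (s≤s k<a) = shift-< a g k k<a

Palindromic : ℕ → ℕ → (ℕ → ℕ) → Set
Palindromic t m g = ∀ j d → j + d ≡ m → g (m + d) ≡ t ^ d * g j

VanishesAbove : ℕ → (ℕ → ℕ) → Set
VanishesAbove N g = ∀ k → N < k → g k ≡ 0

shift-palindromic : ∀ {t m g} a → Palindromic t m g → VanishesAbove (m + m) g →
  Palindromic t (a + m) (shift a g)
shift-palindromic {t} {m} {g} a pal vanish j d j+d≡a+m with a ≤? j
... | yes a≤j with i , refl ← m≤n⇒∃[o]m+o≡n a≤j = begin
  shift a g (a + m + d) ≡⟨ cong (shift a g) (+-assoc a m d) ⟩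
  shift a g (a + (m + d)) ≡⟨ shift-+ a g (m + d) ⟩
  g (m + d)             ≡⟨ pal i d (+-cancelˡ-≡ a _ _ (trans (sym (+-assoc a i d)) j+d≡a+m)) ⟩
  t ^ d * g i           ≡⟨ cong (t ^ d *_) (sym (shift-+ a g i)) ⟩
  t ^ d * shift a g (a + i) ∎
... | no a≰j = begin
  shift a g (a + m + d) ≡⟨ cong (shift a g) (+-assoc a m d) ⟩
  shift a g (a + (m + d)) ≡⟨ shift-+ a g (m + d) ⟩
  g (m + d)             ≡⟨ vanish (m + d) (+-monoʳ-< m m<d) ⟩
  0                     ≡⟨ sym (*-zeroʳ (t ^ d)) ⟩
  t ^ d * 0             ≡⟨ cong (t ^ d *_) (sym (shift-< a g j (≰⇒> a≰j))) ⟩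
  t ^ d * shift a g j   ∎
  where
  m<d : m < d
  m<d = +-cancelˡ-< j m d (subst (j + m <_) (sym j+d≡a+m) (+-monoˡ-< m (≰⇒> a≰j)))

shift-vanishes : ∀ {N g} a → VanishesAbove N g → VanishesAbove (a + N) (shift a g)
shift-vanishes {N} {g} a vanish k a+N<k with a ≤? k
... | no a≰k = shift-< a g k (≰⇒> a≰k)
... | yes a≤k with i , refl ← m≤n⇒∃[o]m+o≡n a≤k =
  trans (shift-+ a g i) (vanish i (+-cancelˡ-< a N i a+N<k))

module TrinomialPower (p t : ℕ) where

  -- coeff z is the coefficient sequence of (1 + p x + t x²)^z
  coeff : ℕ → ℕ → ℕ
  coeff zero    zero    = 1
  coeff zero    (suc k) = 0
  coeff (suc z) k       = coeff z k + p * shift 1 (coeff z) k + t * shift 2 (coeff z) k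

  coeff-vanishes : ∀ z → VanishesAbove (z + z) (coeff z)
  coeff-vanishes zero    (suc k)       _                = refl
  coeff-vanishes (suc z) (suc (suc k)) (s≤s (s≤s 2z+1<k)) =
    cong₂ _+_ (cong₂ _+_ (vanish (m<n⇒m<1+n (m<n⇒m<1+n 2z<k)))
                         (trans (cong (p *_) (vanish (m<n⇒m<1+n 2z<k))) (*-zeroʳ p)))
              (trans (cong (t *_) (vanish 2z<k)) (*-zeroʳ t))
    where
    vanish : ∀ {i} → z + z < i → coeff z i ≡ 0
    vanish = coeff-vanishes z _
    2z<k : z + z < k
    2z<k = subst (_≤ k) (+-suc z z) 2z+1<k

  private
    coeff-suc : ∀ z e → coeff (suc z) (suc z + suc e)
              ≡ coeff z (z + suc (suc e)) + p * coeff z (z + suc e) + t * coeff z (z + e)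
    coeff-suc z e rewrite +-suc z e | +-suc z (suc e) | +-suc z e = refl

    coeff-palindromic-suc : ∀ z → Palindromic t z (coeff z) →
      ∀ j d → j + suc d ≡ suc z → coeff (suc z) (suc z + suc d) ≡ t ^ suc d * coeff (suc z) j
    coeff-palindromic-suc z pal zero d d+1≡z+1 = begin
      coeff (suc z) (suc z + suc d)
        ≡⟨ coeff-suc z d ⟩
      coeff z (z + suc (suc d)) + p * coeff z (z + suc d) + t * coeff z (z + d)
        ≡⟨ cong₂ _+_ (cong₂ _+_ (coeff-vanishes z _ (+-monoʳ-< z (m<n⇒m<1+n z<1+d)))
                                (cong (p *_) (coeff-vanishes z _ (+-monoʳ-< z z<1+d))))
                     (cong (t *_) (pal zero d d≡z)) ⟩
      0 + p * 0 + t * (t ^ d * coeff z 0)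
        ≡⟨ identity p t (t ^ d) (coeff z 0) ⟩
      t ^ suc d * coeff (suc z) 0 ∎
      where
      d≡z : d ≡ z
      d≡z = suc-injective d+1≡z+1
      z<1+d : z < suc d
      z<1+d = subst (_< suc d) d≡z (n<1+n d)
      identity : ∀ p t T X → 0 + p * 0 + t * (T * X) ≡ t * T * (X + p * 0 + t * 0)
      identity = solve-∀
    coeff-palindromic-suc z pal (suc zero) d d+2≡z+1 = begin
      coeff (suc z) (suc z + suc d)
        ≡⟨ coeff-suc z d ⟩
      coeff z (z + suc (suc d)) + p * coeff z (z + suc d) + t * coeff z (z + d)
        ≡⟨ cong₂ _+_ (cong₂ _+_ (coeff-vanishes z _ (+-monoʳ-< z z<2+d))
                                (cong (p *_) (pal zero (suc d) d+1≡z)))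
                     (cong (t *_) (pal 1 d d+1≡z)) ⟩
      0 + p * (t ^ suc d * coeff z 0) + t * (t ^ d * coeff z 1)
        ≡⟨ identity p t (t ^ d) (coeff z 0) (coeff z 1) ⟩
      t ^ suc d * coeff (suc z) 1 ∎
      where
      d+1≡z : suc d ≡ z
      d+1≡z = suc-injective d+2≡z+1
      z<2+d : z < suc (suc d)
      z<2+d = subst (_< suc (suc d)) d+1≡z (n<1+n (suc d))
      identity : ∀ p t T X Y → 0 + p * (t * T * X) + t * (T * Y) ≡ t * T * (Y + p * X + t * 0)
      identity = solve-∀
    coeff-palindromic-suc z pal (suc (suc j)) d j+d+3≡z+1 = begin
      coeff (suc z) (suc z + suc d)
        ≡⟨ coeff-suc z d ⟩
      coeff z (z + suc (suc d)) + p * coeff z (z + suc d) + t * coeff z (z + d)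
        ≡⟨ cong₂ _+_ (cong₂ _+_ (pal j (suc (suc d)) (trans (+-suc j (suc d)) j+d+2≡z))
                                (cong (p *_) (pal (suc j) (suc d) j+d+2≡z)))
                     (cong (t *_) (pal (suc (suc j)) d (trans (sym (+-suc (suc j) d)) j+d+2≡z))) ⟩
      t ^ suc (suc d) * coeff z j + p * (t ^ suc d * coeff z (suc j)) + t * (t ^ d * coeff z (suc (suc j)))
        ≡⟨ identity p t (t ^ d) (coeff z j) (coeff z (suc j)) (coeff z (suc (suc j))) ⟩
      t ^ suc d * coeff (suc z) (suc (suc j)) ∎
      where
      j+d+2≡z : suc j + suc d ≡ z
      j+d+2≡z = suc-injective j+d+3≡z+1
      identity : ∀ p t T X Y Z → t * (t * T) * X + p * (t * T * Y) + t * (T * Z) ≡ t * T * (Z + p * Y + t * X)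
      identity = solve-∀

  coeff-palindromic : ∀ z → Palindromic t z (coeff z)
  coeff-palindromic z j zero j+0≡z
    rewrite +-identityʳ z | +-identityʳ j | j+0≡z = sym (+-identityʳ (coeff z z))
  coeff-palindromic zero    j (suc d) j+d≡0 = ⊥-elim (1+n≢0 (trans (sym (+-suc j d)) j+d≡0))
  coeff-palindromic (suc z) j (suc d) j+d+1≡z+1 = coeff-palindromic-suc z (coeff-palindromic z) j d j+d+1≡z+1

-- Independent sets of the corona

copyOf-combine : ∀ {n p} (c : Fin n) (h : Fin p) → copyOf n p (combine c h) ≡ c
copyOf-combine {n} {p} c h = cong proj₁ (remQuot-combine {n} {p} c h)

posOf-combine : ∀ {n p} (c : Fin n) (h : Fin p) → posOf n p (combine c h) ≡ h
posOf-combine {n} {p} c h = cong proj₂ (remQuot-combine {n} {p} c h)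

lookup-concat-remQuot : ∀ {n p} {A : Set} (Bs : Vec (Vec A p) n) k →
  lookup (concat Bs) k ≡ lookup (lookup Bs (copyOf n p k)) (posOf n p k)
lookup-concat-remQuot {n} {p} Bs k =
  trans (cong (lookup (concat Bs)) (sym (combine-remQuot {n} p k))) (lookup-concat Bs _ _)

size≡ᵇ0⇔ : ∀ {p} (B : Vec Bool p) → T (size B ≡ᵇ 0) ⇔ (∀ h → ¬ T (lookup B h))
size≡ᵇ0⇔ B = mk⇔ (to B) (from B)
  where
  to : ∀ {p} (B : Vec Bool p) → T (size B ≡ᵇ 0) → ∀ h → ¬ T (lookup B h)
  to (false ∷ B) t (suc h) = to B t h
  from : ∀ {p} (B : Vec Bool p) → (∀ h → ¬ T (lookup B h)) → T (size B ≡ᵇ 0)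
  from []          _ = _
  from (true  ∷ B) e = e zero _
  from (false ∷ B) e = from B (e ∘ suc)

-- A vertex set of G ∘ H is written A ++ concat Bs: A on G, and Bs c on the copy of H attached to c.
blockAllowed : ∀ {p} → Graph p → Bool → Vec Bool p → Bool
blockAllowed H a B = if a then size B ≡ᵇ 0 else isIndependent H B

blocksAllowed : ∀ {n p} → Graph p → Vec Bool n → Vec (Vec Bool p) n → Bool
blocksAllowed H []      []       = true
blocksAllowed H (a ∷ A) (B ∷ Bs) = blockAllowed H a B ∧ blocksAllowed H A Bs

BlockAllowed : ∀ {p} → Graph p → Bool → Vec Bool p → Set
BlockAllowed H a B = (T a → ∀ h → ¬ T (lookup B h)) × Independent H B

blockAllowed⇔ : ∀ {p} (H : Graph p) a B → T (blockAllowed H a B) ⇔ BlockAllowed H a B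
blockAllowed⇔ H true  B = mk⇔
  (λ t → let empty = Equivalence.to (size≡ᵇ0⇔ B) t in (λ _ → empty) , (λ h _ h∈ _ → ⊥-elim (empty h h∈)))
  (λ (empty , _) → Equivalence.from (size≡ᵇ0⇔ B) (empty _))
blockAllowed⇔ H false B = mk⇔ (λ t → (λ ()) , isIndependent⇒ H B t) (isIndependent⇐ H B ∘ proj₂)

blocksAllowed⇔ : ∀ {n p} (H : Graph p) A (Bs : Vec (Vec Bool p) n) →
  T (blocksAllowed H A Bs) ⇔ (∀ c → BlockAllowed H (lookup A c) (lookup Bs c))
blocksAllowed⇔ H []      []       = mk⇔ (λ _ ()) (λ _ → _)
blocksAllowed⇔ H (a ∷ A) (B ∷ Bs) = mk⇔
  (λ t → let (t₁ , t₂) = Equivalence.to 𝔹.T-∧ t in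
    λ { zero → Equivalence.to (blockAllowed⇔ H a B) t₁ ; (suc c) → Equivalence.to (blocksAllowed⇔ H A Bs) t₂ c })
  (λ ok → Equivalence.from 𝔹.T-∧
    (Equivalence.from (blockAllowed⇔ H a B) (ok zero) , Equivalence.from (blocksAllowed⇔ H A Bs) (ok ∘ suc)))

module _ {n p} (G : Graph n) (H : Graph p) (A : Vec Bool n) (Bs : Vec (Vec Bool p) n) where

  private
    member : Fin n ⊎ Fin (n * p) → Bool
    member = [ lookup A , lookup (concat Bs) ]′

    CoronaIndependent : Set
    CoronaIndependent = ∀ x y → T (member x) → T (member y) → coronaAdj G H x y ≡ false

    lookup-member : ∀ u → lookup (A ++ concat Bs) u ≡ member (splitAt n u)
    lookup-member = lookup-splitAt n A (concat Bs)

    split : Independent (corona G H) (A ++ concat Bs) → CoronaIndependent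
    split ind x y x∈ y∈ = subst₂ (λ x y → coronaAdj G H x y ≡ false) (splitAt-join n _ x) (splitAt-join n _ y)
      (ind (join n _ x) (join n _ y) (subst T (sym (memberAt x)) x∈) (subst T (sym (memberAt y)) y∈))
      where
      memberAt : ∀ x → lookup (A ++ concat Bs) (join n (n * p) x) ≡ member x
      memberAt x = trans (lookup-member _) (cong member (splitAt-join n _ x))

    unsplit : CoronaIndependent → Independent (corona G H) (A ++ concat Bs)
    unsplit core u v u∈ v∈ =
      core (splitAt n u) (splitAt n v) (subst T (lookup-member u) u∈) (subst T (lookup-member v) v∈)

    decompose : CoronaIndependent → Independent G A × (∀ c → BlockAllowed H (lookup A c) (lookup Bs c))
    decompose core = (λ i j → core (inj₁ i) (inj₁ j)) , λ c → emptyIfMember c , blockIndependent c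
      where
      inBlock : ∀ c h → T (lookup (lookup Bs c) h) → T (member (inj₂ (combine c h)))
      inBlock c h = subst T (sym (lookup-concat Bs c h))
      emptyIfMember : ∀ c → T (lookup A c) → ∀ h → ¬ T (lookup (lookup Bs c) h)
      emptyIfMember c c∈ h h∈ with core (inj₁ c) (inj₂ (combine c h)) c∈ (inBlock c h h∈)
      ... | adjacent rewrite copyOf-combine c h | eqF-refl c with adjacent
      ...   | ()
      blockIndependent : ∀ c → Independent H (lookup Bs c)
      blockIndependent c h h′ h∈ h′∈
        with core (inj₂ (combine c h)) (inj₂ (combine c h′)) (inBlock c h h∈) (inBlock c h′ h′∈)
      ... | nonadjacent
        rewrite copyOf-combine c h | copyOf-combine c h′ | posOf-combine c h | posOf-combine c h′ | eqF-refl c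
        = nonadjacent

    assemble : Independent G A × (∀ c → BlockAllowed H (lookup A c) (lookup Bs c)) → CoronaIndependent
    assemble (indG , ok) (inj₁ i) (inj₁ j) i∈ j∈ = indG i j i∈ j∈
    assemble (indG , ok) (inj₁ i) (inj₂ k) i∈ k∈ = notAttached i k i∈ k∈
      where
      notAttached : ∀ i k → T (lookup A i) → T (lookup (concat Bs) k) → eqF i (copyOf n p k) ≡ false
      notAttached i k i∈ k∈ with i Fin.≟ copyOf n p k
      ... | no _     = refl
      ... | yes refl = ⊥-elim (proj₁ (ok i) i∈ (posOf n p k) (subst T (lookup-concat-remQuot Bs k) k∈))
    assemble (indG , ok) (inj₂ k) (inj₁ j) k∈ j∈ =
      trans (eqF-sym (copyOf n p k) j) (assemble (indG , ok) (inj₁ j) (inj₂ k) j∈ k∈)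
    assemble (indG , ok) (inj₂ k) (inj₂ l) k∈ l∈ with copyOf n p k Fin.≟ copyOf n p l
    ... | no  _  = refl
    ... | yes eq = proj₂ (ok (copyOf n p k)) (posOf n p k) (posOf n p l)
      (subst T (lookup-concat-remQuot Bs k) k∈)
      (subst T (trans (lookup-concat-remQuot Bs l) (cong (λ c → lookup (lookup Bs c) (posOf n p l)) (sym eq))) l∈)

  isIndependent-corona :
    isIndependent (corona G H) (A ++ concat Bs) ≡ isIndependent G A ∧ blocksAllowed H A Bs
  isIndependent-corona = T⇔T⇒≡ (mk⇔
    (λ t → let (indG , ok) = decompose (split (isIndependent⇒ (corona G H) (A ++ concat Bs) t)) in
      Equivalence.from 𝔹.T-∧ (isIndependent⇐ G A indG , Equivalence.from (blocksAllowed⇔ H A Bs) ok))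
    (λ t → let (t₁ , t₂) = Equivalence.to 𝔹.T-∧ t in
      isIndependent⇐ (corona G H) (A ++ concat Bs)
        (unsplit (assemble (isIndependent⇒ G A t₁ , Equivalence.to (blocksAllowed⇔ H A Bs) t₂)))))

-- The independence polynomial of the corona

∑ᵇ : ∀ {p} n → (Vec (Vec Bool p) n → ℕ) → ℕ
∑ᵇ zero        w = w []
∑ᵇ {p} (suc n) w = ∑ₛ p (λ B → ∑ᵇ n (λ Bs → w (B ∷ Bs)))

∑ᵇ-cong : ∀ {p} n {v w : Vec (Vec Bool p) n → ℕ} → (∀ Bs → v Bs ≡ w Bs) → ∑ᵇ n v ≡ ∑ᵇ n w
∑ᵇ-cong zero        e = e []
∑ᵇ-cong {p} (suc n) e = ∑ₛ-cong p (λ B → ∑ᵇ-cong n (λ Bs → e (B ∷ Bs)))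

∑ᵇ-*ˡ : ∀ {p} n c (w : Vec (Vec Bool p) n → ℕ) → ∑ᵇ n (λ Bs → c * w Bs) ≡ c * ∑ᵇ n w
∑ᵇ-*ˡ zero        c w = refl
∑ᵇ-*ˡ {p} (suc n) c w = trans (∑ₛ-cong p (λ B → ∑ᵇ-*ˡ n c _)) (∑ₛ-*ˡ p c _)

∑ᵇ-zero : ∀ {p} n {w : Vec (Vec Bool p) n → ℕ} → (∀ Bs → w Bs ≡ 0) → ∑ᵇ n w ≡ 0
∑ᵇ-zero zero        e = e []
∑ᵇ-zero {p} (suc n) e = ∑ₛ-zero p (λ B → ∑ᵇ-zero n (λ Bs → e (B ∷ Bs)))

∑ₛ-concat : ∀ {p} n (w : Vec Bool (n * p) → ℕ) → ∑ₛ (n * p) w ≡ ∑ᵇ n (λ Bs → w (concat Bs))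
∑ₛ-concat zero        w = refl
∑ₛ-concat {p} (suc n) w = trans (∑ₛ-++ p (n * p) w) (∑ₛ-cong p (λ B → ∑ₛ-concat n (λ C → w (B ++ C))))

shift-cong : ∀ a {f g : ℕ → ℕ} → (∀ k → f k ≡ g k) → ∀ k → shift a f k ≡ shift a g k
shift-cong zero    e k       = e k
shift-cong (suc a) e zero    = refl
shift-cong (suc a) e (suc k) = shift-cong a e k

∑ᵇ-shift : ∀ {p} n r (x : Vec (Vec Bool p) n → ℕ) (g : Vec (Vec Bool p) n → ℕ → ℕ) k →
  ∑ᵇ n (λ Bs → x Bs * shift r (g Bs) k) ≡ shift r (λ k′ → ∑ᵇ n (λ Bs → x Bs * g Bs k′)) k
∑ᵇ-shift n zero    x g k       = refl
∑ᵇ-shift n (suc r) x g zero    = ∑ᵇ-zero n (λ Bs → *-zeroʳ (x Bs))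
∑ᵇ-shift n (suc r) x g (suc k) = ∑ᵇ-shift n r x g k

𝟙-≡ᵇ-shift : ∀ r s k → 𝟙 (r + s ≡ᵇ k) ≡ shift r (λ k′ → 𝟙 (s ≡ᵇ k′)) k
𝟙-≡ᵇ-shift zero    s k       = refl
𝟙-≡ᵇ-shift (suc r) s zero    = refl
𝟙-≡ᵇ-shift (suc r) s (suc k) = 𝟙-≡ᵇ-shift r s k

size-++ : ∀ {a b} (S : Vec Bool a) (U : Vec Bool b) → size (S ++ U) ≡ size S + size U
size-++ []          U = refl
size-++ (true  ∷ S) U = cong suc (size-++ S U)
size-++ (false ∷ S) U = size-++ S U

size-∅ : ∀ n → size (∅ {n}) ≡ 0
size-∅ zero    = refl
size-∅ (suc n) = size-∅ n

size+size-complement : ∀ {n} (A : Vec Bool n) → size A + size (∁ A) ≡ n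
size+size-complement []          = refl
size+size-complement (true  ∷ A) = cong suc (size+size-complement A)
size+size-complement (false ∷ A) = trans (+-suc (size A) _) (cong suc (size+size-complement A))

∑-independent-by-size : ∀ {p} (H : Graph p) → (∀ B → isIndependent H B ≡ true → size B ≤ 2) → (φ : ℕ → ℕ) →
  ∑ₛ p (λ B → 𝟙 (isIndependent H B) * φ (size B)) ≡ φ 0 + p * φ 1 + nonEdgeCount H * φ 2
∑-independent-by-size {p} H α≤2 φ = begin
  ∑ₛ p (λ B → 𝟙 (isIndependent H B) * φ (size B))
    ≡⟨ ∑ₛ-cong p bySize ⟩
  ∑ₛ p (λ B → count 0 B * φ 0 + count 1 B * φ 1 + count 2 B * φ 2)
    ≡⟨ ∑ₛ-distrib-+ p (λ B → count 0 B * φ 0 + count 1 B * φ 1) (λ B → count 2 B * φ 2) ⟩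
  ∑ₛ p (λ B → count 0 B * φ 0 + count 1 B * φ 1) + ∑ₛ p (λ B → count 2 B * φ 2)
    ≡⟨ cong (_+ ∑ₛ p (λ B → count 2 B * φ 2)) (∑ₛ-distrib-+ p (λ B → count 0 B * φ 0) (λ B → count 1 B * φ 1)) ⟩
  ∑ₛ p (λ B → count 0 B * φ 0) + ∑ₛ p (λ B → count 1 B * φ 1) + ∑ₛ p (λ B → count 2 B * φ 2)
    ≡⟨ cong₂ _+_ (cong₂ _+_ (∑ₛ-*ʳ p (φ 0) _) (∑ₛ-*ʳ p (φ 1) _)) (∑ₛ-*ʳ p (φ 2) _) ⟩
  ∑ₛ p (count 0) * φ 0 + ∑ₛ p (count 1) * φ 1 + ∑ₛ p (count 2) * φ 2
    ≡⟨ cong₂ _+_ (cong₂ _+_ (cong (_* φ 0) (countAt 0 (indepCount-0 H))) (cong (_* φ 1) (countAt 1 (indepCount-1 H))))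
                 (cong (_* φ 2) (countAt 2 (indepCount-2 H))) ⟩
  1 * φ 0 + p * φ 1 + nonEdgeCount H * φ 2
    ≡⟨ cong (λ x → x + p * φ 1 + nonEdgeCount H * φ 2) (*-identityˡ (φ 0)) ⟩
  φ 0 + p * φ 1 + nonEdgeCount H * φ 2 ∎
  where
  count : ℕ → Vec Bool p → ℕ
  count k B = 𝟙 (isIndependent H B) * 𝟙 (size B ≡ᵇ k)
  countAt : ∀ k {c} → indepCount H k ≡ c → ∑ₛ p (count k) ≡ c
  countAt k = trans (sym (indepCount-∑ₛ H k))
  bySize : ∀ B → 𝟙 (isIndependent H B) * φ (size B) ≡ count 0 B * φ 0 + count 1 B * φ 1 + count 2 B * φ 2
  bySize B with isIndependent H B in ind
  ... | false = refl
  ... | true with size B | α≤2 B ind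
  ...   | 0 | _ = sym (trans (+-identityʳ _) (+-identityʳ _))
  ...   | 1 | _ = sym (+-identityʳ _)
  ...   | 2 | _ = refl
  ...   | suc (suc (suc _)) | s≤s (s≤s ())

∑ᵇ-factor : ∀ {p m} n x (U : Vec Bool m) (ok : Vec (Vec Bool p) n → Bool) k →
  ∑ᵇ n (λ Bs → 𝟙 (x ∧ ok Bs) * 𝟙 (size (U ++ concat Bs) ≡ᵇ k))
  ≡ 𝟙 x * shift (size U) (λ k′ → ∑ᵇ n (λ Bs → 𝟙 (ok Bs) * 𝟙 (size (concat Bs) ≡ᵇ k′))) k
∑ᵇ-factor n x U ok k = begin
  ∑ᵇ n (λ Bs → 𝟙 (x ∧ ok Bs) * 𝟙 (size (U ++ concat Bs) ≡ᵇ k))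
    ≡⟨ ∑ᵇ-cong n (λ Bs → trans (cong₂ _*_ (𝟙-∧ x (ok Bs)) (sizeShift Bs)) (*-assoc (𝟙 x) _ _)) ⟩
  ∑ᵇ n (λ Bs → 𝟙 x * (𝟙 (ok Bs) * shift (size U) (λ k′ → 𝟙 (size (concat Bs) ≡ᵇ k′)) k))
    ≡⟨ ∑ᵇ-*ˡ n (𝟙 x) _ ⟩
  𝟙 x * ∑ᵇ n (λ Bs → 𝟙 (ok Bs) * shift (size U) (λ k′ → 𝟙 (size (concat Bs) ≡ᵇ k′)) k)
    ≡⟨ cong (𝟙 x *_) (∑ᵇ-shift n (size U) (𝟙 ∘ ok) _ k) ⟩
  𝟙 x * shift (size U) (λ k′ → ∑ᵇ n (λ Bs → 𝟙 (ok Bs) * 𝟙 (size (concat Bs) ≡ᵇ k′))) k ∎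
  where
  sizeShift : ∀ Bs → 𝟙 (size (U ++ concat Bs) ≡ᵇ k) ≡ shift (size U) (λ k′ → 𝟙 (size (concat Bs) ≡ᵇ k′)) k
  sizeShift Bs = trans (cong (λ s → 𝟙 (s ≡ᵇ k)) (size-++ U (concat Bs))) (𝟙-≡ᵇ-shift (size U) _ k)

*-palindromic : ∀ {t m g} c → Palindromic t m g → Palindromic t m (λ k → c * g k)
*-palindromic {t} {m} {g} c pal j d j+d≡m = begin
  c * g (m + d)       ≡⟨ cong (c *_) (pal j d j+d≡m) ⟩
  c * (t ^ d * g j)   ≡⟨ sym (*-assoc c (t ^ d) (g j)) ⟩
  c * t ^ d * g j     ≡⟨ cong (_* g j) (*-comm c (t ^ d)) ⟩
  t ^ d * c * g j     ≡⟨ *-assoc (t ^ d) c (g j) ⟩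
  t ^ d * (c * g j)   ∎

∑ₛ-palindromic : ∀ {t m} N (f : Vec Bool N → ℕ → ℕ) → (∀ S → Palindromic t m (f S)) →
  Palindromic t m (λ k → ∑ₛ N (λ S → f S k))
∑ₛ-palindromic {t} N f pal j d j+d≡m = trans (∑ₛ-cong N (λ S → pal S j d j+d≡m)) (∑ₛ-*ˡ N (t ^ d) (λ S → f S j))

∑ₛ-vanishes : ∀ {M} N (f : Vec Bool N → ℕ → ℕ) → (∀ S → VanishesAbove M (f S)) →
  VanishesAbove M (λ k → ∑ₛ N (λ S → f S k))
∑ₛ-vanishes N f vanish k M<k = ∑ₛ-zero N (λ S → vanish S k M<k)

module _ {p} (H : Graph p) (α≤2 : ∀ B → isIndependent H B ≡ true → size B ≤ 2) where

  open TrinomialPower p (nonEdgeCount H)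

  blocks-coeff : ∀ {n} (A : Vec Bool n) k →
    ∑ᵇ n (λ Bs → 𝟙 (blocksAllowed H A Bs) * 𝟙 (size (concat Bs) ≡ᵇ k)) ≡ coeff (size (∁ A)) k
  blocks-coeff []      zero    = refl
  blocks-coeff []      (suc k) = refl
  blocks-coeff {suc n} (a ∷ A) k = begin
    ∑ₛ p (λ B → ∑ᵇ n (λ Bs → 𝟙 (blockAllowed H a B ∧ blocksAllowed H A Bs) * 𝟙 (size (B ++ concat Bs) ≡ᵇ k)))
      ≡⟨ ∑ₛ-cong p (λ B → trans (∑ᵇ-factor n (blockAllowed H a B) B (blocksAllowed H A) k)
                                (cong (𝟙 (blockAllowed H a B) *_) (shift-cong (size B) (blocks-coeff A) k))) ⟩
    ∑ₛ p (λ B → 𝟙 (blockAllowed H a B) * shift (size B) (coeff (size (∁ A))) k)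
      ≡⟨ block a ⟩
    coeff (size (∁ (a ∷ A))) k ∎
    where
    block : ∀ a → ∑ₛ p (λ B → 𝟙 (blockAllowed H a B) * shift (size B) (coeff (size (∁ A))) k)
                ≡ coeff (size (∁ (a ∷ A))) k
    block true  = trans (∑ₛ-empty p _) (cong (λ s → shift s (coeff (size (∁ A))) k) (size-∅ p))
    block false = ∑-independent-by-size H α≤2 (λ s → shift s (coeff (size (∁ A))) k)

  indepCount-corona : ∀ {n} (G : Graph n) k → indepCount (corona G H) k
    ≡ ∑ₛ n (λ A → 𝟙 (isIndependent G A) * shift (size A) (coeff (size (∁ A))) k)
  indepCount-corona {n} G k = begin
    indepCount (corona G H) k
      ≡⟨ indepCount-∑ₛ (corona G H) k ⟩
    ∑ₛ (n + n * p) (λ S → 𝟙 (isIndependent (corona G H) S) * 𝟙 (size S ≡ᵇ k))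
      ≡⟨ ∑ₛ-++ n (n * p) _ ⟩
    ∑ₛ n (λ A → ∑ₛ (n * p) (λ C → 𝟙 (isIndependent (corona G H) (A ++ C)) * 𝟙 (size (A ++ C) ≡ᵇ k)))
      ≡⟨ ∑ₛ-cong n (λ A → trans (∑ₛ-concat n _) (attached A)) ⟩
    ∑ₛ n (λ A → 𝟙 (isIndependent G A) * shift (size A) (coeff (size (∁ A))) k) ∎
    where
    attached : ∀ A → ∑ᵇ n (λ Bs → 𝟙 (isIndependent (corona G H) (A ++ concat Bs)) * 𝟙 (size (A ++ concat Bs) ≡ᵇ k))
                   ≡ 𝟙 (isIndependent G A) * shift (size A) (coeff (size (∁ A))) k
    attached A = begin
      ∑ᵇ n (λ Bs → 𝟙 (isIndependent (corona G H) (A ++ concat Bs)) * 𝟙 (size (A ++ concat Bs) ≡ᵇ k))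
        ≡⟨ ∑ᵇ-cong n (λ Bs → cong (λ b → 𝟙 b * 𝟙 (size (A ++ concat Bs) ≡ᵇ k)) (isIndependent-corona G H A Bs)) ⟩
      ∑ᵇ n (λ Bs → 𝟙 (isIndependent G A ∧ blocksAllowed H A Bs) * 𝟙 (size (A ++ concat Bs) ≡ᵇ k))
        ≡⟨ ∑ᵇ-factor n (isIndependent G A) A (blocksAllowed H A) k ⟩
      𝟙 (isIndependent G A)
        * shift (size A) (λ k′ → ∑ᵇ n (λ Bs → 𝟙 (blocksAllowed H A Bs) * 𝟙 (size (concat Bs) ≡ᵇ k′))) k
        ≡⟨ cong (𝟙 (isIndependent G A) *_) (shift-cong (size A) (blocks-coeff A) k) ⟩
      𝟙 (isIndependent G A) * shift (size A) (coeff (size (∁ A))) k ∎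

  private
    coronaTerm : ∀ {n} → Graph n → Vec Bool n → ℕ → ℕ
    coronaTerm G A = λ k → 𝟙 (isIndependent G A) * shift (size A) (coeff (size (∁ A))) k

  corona-palindromic : ∀ {n} (G : Graph n) → Palindromic (nonEdgeCount H) n (indepCount (corona G H))
  corona-palindromic {n} G j d j+d≡n = begin
    indepCount (corona G H) (n + d)                 ≡⟨ indepCount-corona G (n + d) ⟩
    ∑ₛ n (λ A → coronaTerm G A (n + d))             ≡⟨ ∑ₛ-palindromic n (coronaTerm G) term j d j+d≡n ⟩
    nonEdgeCount H ^ d * ∑ₛ n (λ A → coronaTerm G A j) ≡⟨ cong (nonEdgeCount H ^ d *_) (sym (indepCount-corona G j)) ⟩
    nonEdgeCount H ^ d * indepCount (corona G H) j  ∎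
    where
    term : ∀ A → Palindromic (nonEdgeCount H) n (coronaTerm G A)
    term A = *-palindromic (𝟙 (isIndependent G A))
      (subst (λ m → Palindromic (nonEdgeCount H) m (shift (size A) (coeff (size (∁ A)))))
             (size+size-complement A)
             (shift-palindromic (size A) (coeff-palindromic (size (∁ A))) (coeff-vanishes (size (∁ A)))))

  corona-vanishes : ∀ {n} (G : Graph n) → VanishesAbove (n + n) (indepCount (corona G H))
  corona-vanishes {n} G k 2n<k = trans (indepCount-corona G k) (∑ₛ-vanishes n (coronaTerm G) term k 2n<k)
    where
    term : ∀ A → VanishesAbove (n + n) (coronaTerm G A)
    term A k 2n<k = trans
      (cong (𝟙 (isIndependent G A) *_) (shift-vanishes (size A) (coeff-vanishes z) k (≤-<-trans degree 2n<k)))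
      (*-zeroʳ (𝟙 (isIndependent G A)))
      where
      z : ℕ
      z = size (∁ A)
      degree : size A + (z + z) ≤ n + n
      degree = subst (λ m → size A + (z + z) ≤ m + m) (size+size-complement A)
        (≤-trans (m≤n+m (size A + (z + z)) (size A)) (≤-reflexive (rearrange (size A) z)))
        where
        rearrange : ∀ a z → a + (a + (z + z)) ≡ (a + z) + (a + z)
        rearrange = solve-∀

  indepCount-corona-top : ∀ {n} (G : Graph n) → indepCount (corona G H) (n + n) ≡ nonEdgeCount H ^ n
  indepCount-corona-top {n} G = begin
    indepCount (corona G H) (n + n)                     ≡⟨ corona-palindromic G 0 n refl ⟩
    nonEdgeCount H ^ n * indepCount (corona G H) 0      ≡⟨ cong (nonEdgeCount H ^ n *_) (indepCount-0 (corona G H)) ⟩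
    nonEdgeCount H ^ n * 1                              ≡⟨ *-identityʳ _ ⟩
    nonEdgeCount H ^ n                                  ∎

  indepNumber-corona : ∀ {n} (G : Graph n) → nonEdgeCount H ≢ 0 → indepNumber (corona G H) ≡ n + n
  indepNumber-corona {n} G t≢0 = indepNumber-unique (corona G H) (n + n) top≢0 (corona-vanishes G)
    where
    top≢0 : indepCount (corona G H) (n + n) ≢ 0
    top≢0 top≡0 = t≢0 (m^n≡0⇒m≡0 (nonEdgeCount H) n (trans (sym (indepCount-corona-top G)) top≡0))

-- Graphs with a single non-edge

∑≡0⇒ : ∀ {N} (f : Fin N → ℕ) → ∑[ i < N ] f i ≡ 0 → ∀ i → f i ≡ 0
∑≡0⇒ f ∑≡0 zero    = m+n≡0⇒m≡0 (f zero) ∑≡0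
∑≡0⇒ f ∑≡0 (suc i) = ∑≡0⇒ (f ∘ suc) (m+n≡0⇒n≡0 (f zero) ∑≡0) i

∑-zero : ∀ N {f : Fin N → ℕ} → (∀ i → f i ≡ 0) → ∑[ i < N ] f i ≡ 0
∑-zero zero    _ = refl
∑-zero (suc N) e = cong₂ _+_ (e zero) (∑-zero N (e ∘ suc))

∑-unique : ∀ {N} (f : Fin N → ℕ) x → (∀ i → i ≢ x → f i ≡ 0) → ∑[ i < N ] f i ≡ f x
∑-unique {suc N} f zero    others =
  trans (cong (f zero +_) (∑-zero N (λ i → others (suc i) (λ ())))) (+-identityʳ (f zero))
∑-unique {suc N} f (suc x) others =
  trans (cong (_+ ∑[ i < N ] f (suc i)) (others zero (λ ())))
        (∑-unique (f ∘ suc) x (λ i i≢x → others (suc i) (i≢x ∘ Fin.suc-injective)))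

∑≡1⇒ : ∀ {N} (f : Fin N → ℕ) → ∑[ i < N ] f i ≡ 1 → ∃[ x ] f x ≡ 1 × (∀ i → i ≢ x → f i ≡ 0)
∑≡1⇒ {suc N} f ∑≡1 with f zero in f0
... | 0 with ∑≡1⇒ (f ∘ suc) ∑≡1
...   | x , fx≡1 , others = suc x , fx≡1 , λ { zero _ → f0 ; (suc i) i≢x → others i (i≢x ∘ cong suc) }
∑≡1⇒ {suc N} f ∑≡1 | 1 =
  zero , f0 , λ { zero 0≢0 → ⊥-elim (0≢0 refl) ; (suc i) _ → ∑≡0⇒ (f ∘ suc) (suc-injective ∑≡1) i }
∑≡1⇒ {suc N} f ∑≡1 | suc (suc _) with () ← suc-injective ∑≡1

𝟙≡0 : ∀ {b} → ¬ T b → 𝟙 b ≡ 0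
𝟙≡0 {false} _ = refl
𝟙≡0 {true}  ¬t = ⊥-elim (¬t _)

𝟙≡1 : ∀ {b} → T b → 𝟙 b ≡ 1
𝟙≡1 {true} _ = refl

𝟙≡1⇒T : ∀ {b} → 𝟙 b ≡ 1 → T b
𝟙≡1⇒T {true} _ = _

∑∑𝟙≡1⇔ : ∀ {N} (b : Fin N → Fin N → Bool) →
  ∑[ i < N ] ∑[ j < N ] 𝟙 (b i j) ≡ 1 ⇔ ∃₂ λ x y → ∀ i j → T (b i j) ⇔ (i ≡ x × j ≡ y)
∑∑𝟙≡1⇔ {N} b = mk⇔ to from
  where
  to : ∑[ i < N ] ∑[ j < N ] 𝟙 (b i j) ≡ 1 → ∃₂ λ x y → ∀ i j → T (b i j) ⇔ (i ≡ x × j ≡ y)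
  to ∑≡1 with x , row≡1 , otherRows ← ∑≡1⇒ _ ∑≡1 with y , bxy≡1 , otherCols ← ∑≡1⇒ _ row≡1 =
    x , y , λ i j → mk⇔ (located i j) λ { (refl , refl) → 𝟙≡1⇒T bxy≡1 }
    where
    located : ∀ i j → T (b i j) → i ≡ x × j ≡ y
    located i j t with i Fin.≟ x | j Fin.≟ y
    ... | no i≢x    | _        = ⊥-elim (1+n≢0 (trans (sym (𝟙≡1 t)) (∑≡0⇒ _ (otherRows i i≢x) j)))
    ... | yes refl  | no j≢y   = ⊥-elim (1+n≢0 (trans (sym (𝟙≡1 t)) (otherCols j j≢y)))
    ... | yes i≡x   | yes j≡y  = i≡x , j≡y
  from : (∃₂ λ x y → ∀ i j → T (b i j) ⇔ (i ≡ x × j ≡ y)) → ∑[ i < N ] ∑[ j < N ] 𝟙 (b i j) ≡ 1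
  from (x , y , spec) = begin
    ∑[ i < N ] ∑[ j < N ] 𝟙 (b i j)
      ≡⟨ ∑-unique _ x (λ i i≢x → ∑-zero N (λ j → 𝟙≡0 (i≢x ∘ proj₁ ∘ Equivalence.to (spec i j)))) ⟩
    ∑[ j < N ] 𝟙 (b x j)
      ≡⟨ ∑-unique _ y (λ j j≢y → 𝟙≡0 (j≢y ∘ proj₂ ∘ Equivalence.to (spec x j))) ⟩
    𝟙 (b x y)
      ≡⟨ 𝟙≡1 (Equivalence.from (spec x y) (refl , refl)) ⟩
    1 ∎

SamePair : ∀ {N} → Fin N → Fin N → Fin N → Fin N → Set
SamePair x y i j = (i ≡ x × j ≡ y) ⊎ (i ≡ y × j ≡ x)

SamePair-map : ∀ {M N} (f : Fin M → Fin N) {x y i j} → SamePair x y i j → SamePair (f x) (f y) (f i) (f j)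
SamePair-map f (inj₁ (refl , refl)) = inj₁ (refl , refl)
SamePair-map f (inj₂ (refl , refl)) = inj₂ (refl , refl)

UniqueNonEdge : ∀ {N} → Graph N → Fin N → Fin N → Set
UniqueNonEdge G x y = x ≢ y × (∀ i j → i ≢ j → adj G i j ≡ false ⇔ SamePair x y i j)

UniqueNonEdge-sym : ∀ {N} {G : Graph N} {x y} → UniqueNonEdge G x y → UniqueNonEdge G y x
UniqueNonEdge-sym (x≢y , spec) = x≢y ∘ sym , λ i j i≢j → mk⇔
  (swap ∘ Equivalence.to (spec i j i≢j)) (Equivalence.from (spec i j i≢j) ∘ swap)
  where
  swap : ∀ {x y i j} → SamePair x y i j → SamePair y x i j
  swap (inj₁ p) = inj₂ p
  swap (inj₂ p) = inj₁ p

nonEdgeCount≡1⇔ : ∀ {N} (G : Graph N) → nonEdgeCount G ≡ 1 ⇔ ∃₂ (UniqueNonEdge G)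
nonEdgeCount≡1⇔ {N} G = mk⇔
  (λ ∑≡1 → let (x , y , spec) = Equivalence.to (∑∑𝟙≡1⇔ _) ∑≡1 in x , y , unordered spec)
  (λ (x , y , u) → Equivalence.from (∑∑𝟙≡1⇔ _) (ordered x y u))
  where
  NonEdge : Fin N → Fin N → Bool
  NonEdge i j = (toℕ i <ᵇ toℕ j) ∧ not (adj G i j)
  T-NonEdge : ∀ i j → T (NonEdge i j) ⇔ (toℕ i < toℕ j × adj G i j ≡ false)
  T-NonEdge i j = mk⇔
    (λ t → let (t₁ , t₂) = Equivalence.to 𝔹.T-∧ t in <ᵇ⇒< _ _ t₁ , Equivalence.to 𝔹.T-not-≡ t₂)
    (λ (i<j , a) → Equivalence.from 𝔹.T-∧ (<⇒<ᵇ i<j , Equivalence.from 𝔹.T-not-≡ a))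
  unordered : ∀ {x y} → (∀ i j → T (NonEdge i j) ⇔ (i ≡ x × j ≡ y)) → UniqueNonEdge G x y
  unordered {x} {y} spec = Fin.<⇒≢ x<y , λ i j i≢j → mk⇔ (classify i j i≢j) nonAdjacent
    where
    x<y×adj-xy : toℕ x < toℕ y × adj G x y ≡ false
    x<y×adj-xy = Equivalence.to (T-NonEdge x y) (Equivalence.from (spec x y) (refl , refl))
    x<y : toℕ x < toℕ y
    x<y = proj₁ x<y×adj-xy
    adj-xy : adj G x y ≡ false
    adj-xy = proj₂ x<y×adj-xy
    classify : ∀ i j → i ≢ j → adj G i j ≡ false → SamePair x y i j
    classify i j i≢j a with Fin.<-cmp i j
    ... | tri< i<j _ _ = inj₁ (Equivalence.to (spec i j) (Equivalence.from (T-NonEdge i j) (i<j , a)))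
    ... | tri≈ _ i≡j _ = ⊥-elim (i≢j i≡j)
    ... | tri> _ _ j<i =
      let (j≡x , i≡y) = Equivalence.to (spec j i) (Equivalence.from (T-NonEdge j i) (j<i , trans (adjSym G j i) a))
      in inj₂ (i≡y , j≡x)
    nonAdjacent : ∀ {i j} → SamePair x y i j → adj G i j ≡ false
    nonAdjacent (inj₁ (refl , refl)) = adj-xy
    nonAdjacent (inj₂ (refl , refl)) = trans (adjSym G y x) adj-xy
  ordered′ : ∀ {x y} → toℕ x < toℕ y → UniqueNonEdge G x y → ∀ i j → T (NonEdge i j) ⇔ (i ≡ x × j ≡ y)
  ordered′ {x} {y} x<y (x≢y , spec) i j = mk⇔
    (λ t → let (i<j , a) = Equivalence.to (T-NonEdge i j) t in pick i<j (Equivalence.to (spec i j (Fin.<⇒≢ i<j)) a))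
    (λ { (refl , refl) →
      Equivalence.from (T-NonEdge x y) (x<y , Equivalence.from (spec x y x≢y) (inj₁ (refl , refl))) })
    where
    pick : toℕ i < toℕ j → SamePair x y i j → i ≡ x × j ≡ y
    pick _   (inj₁ p)             = p
    pick i<j (inj₂ (refl , refl)) = ⊥-elim (<-asym i<j x<y)
  ordered : ∀ x y → UniqueNonEdge G x y → ∃₂ λ x y → ∀ i j → T (NonEdge i j) ⇔ (i ≡ x × j ≡ y)
  ordered x y u@(x≢y , _) with Fin.<-cmp x y
  ... | tri< x<y _ _ = x , y , ordered′ x<y u
  ... | tri≈ _ x≡y _ = ⊥-elim (x≢y x≡y)
  ... | tri> _ _ y<x = y , x , ordered′ y<x (UniqueNonEdge-sym {G = G} u)

eqF⇒≡ : ∀ {N} {i j : Fin N} → T (eqF i j) → i ≡ j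
eqF⇒≡ {i = i} {j} t with i Fin.≟ j
... | yes i≡j = i≡j

UniqueNonEdge-KminusE : ∀ m → UniqueNonEdge (KminusE m) zero (suc zero)
UniqueNonEdge-KminusE m = (λ ()) , λ i j i≢j → mk⇔ (classify i j i≢j) nonAdjacent
  where
  0F 1F : Fin (suc (suc m))
  0F = zero
  1F = suc zero
  removed : ∀ i j → T (eqF i j ∨ (eqF i 0F ∧ eqF j 1F)) → i ≢ j → i ≡ 0F × j ≡ 1F
  removed i j t i≢j with Equivalence.to (𝔹.T-∨ {eqF i j}) t
  ... | inj₁ i≡j = ⊥-elim (i≢j (eqF⇒≡ i≡j))
  ... | inj₂ t′  = let (i≡0 , j≡1) = Equivalence.to (𝔹.T-∧ {eqF i 0F}) t′ in eqF⇒≡ i≡0 , eqF⇒≡ j≡1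
  classify : ∀ i j → i ≢ j → adj (KminusE m) i j ≡ false → SamePair 0F 1F i j
  classify i j i≢j a with Equivalence.to 𝔹.T-∨ (Equivalence.from 𝔹.T-≡ (𝔹.not-injective a))
  ... | inj₁ t = inj₁ (removed i j t i≢j)
  ... | inj₂ t = let (j≡0 , i≡1) = removed j i t (i≢j ∘ sym) in inj₂ (i≡1 , j≡0)
  nonAdjacent : ∀ {i j} → SamePair 0F 1F i j → adj (KminusE m) i j ≡ false
  nonAdjacent (inj₁ (refl , refl)) = refl
  nonAdjacent (inj₂ (refl , refl)) = refl

UniqueNonEdge-≅ : ∀ {M N} {G : Graph M} {H : Graph N} (I : G ≅ H) {x y} →
  UniqueNonEdge H x y → UniqueNonEdge G (_≅_.from I x) (_≅_.from I y)
UniqueNonEdge-≅ {G = G} {H} I {x} {y} (x≢y , spec) = fx≢fy , λ i j i≢j → mk⇔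
  (λ a → back (Equivalence.to (spec (to i) (to j) (i≢j ∘ to-injective)) (trans (sym (preserves i j)) a)))
  (λ p → trans (preserves i j) (Equivalence.from (spec (to i) (to j) (i≢j ∘ to-injective)) (forth p)))
  where
  open _≅_ I
  to-injective : ∀ {i j} → to i ≡ to j → i ≡ j
  to-injective {i} {j} e = trans (sym (from∘to i)) (trans (cong from e) (from∘to j))
  fx≢fy : from x ≢ from y
  fx≢fy e = x≢y (trans (sym (to∘from x)) (trans (cong to e) (to∘from y)))
  back : ∀ {i j} → SamePair x y (to i) (to j) → SamePair (from x) (from y) i j
  back {i} {j} p = subst₂ (SamePair (from x) (from y)) (from∘to i) (from∘to j) (SamePair-map from p)
  forth : ∀ {i j} → SamePair (from x) (from y) i j → SamePair x y (to i) (to j)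
  forth p = subst₂ (λ x y → SamePair x y _ _) (to∘from x) (to∘from y) (SamePair-map to p)

module _ {N} (i j : Fin N) where

  transpose-right : Components.transpose i j j ≡ i
  transpose-right with j Fin.≟ i
  ... | yes refl = refl
  ... | no  _    rewrite dec-true (j Fin.≟ j) refl = refl

  transpose-other : ∀ {k} → k ≢ i → k ≢ j → Components.transpose i j k ≡ k
  transpose-other {k} k≢i k≢j rewrite dec-false (k Fin.≟ i) k≢i | dec-false (k Fin.≟ j) k≢j = refl

permutation-to-01 : ∀ {m} (x y : Fin (suc (suc m))) → x ≢ y →
  ∃[ σ ] σ ⟨$⟩ʳ x ≡ zero × σ ⟨$⟩ʳ y ≡ suc zero
permutation-to-01 {m} x y x≢y = transpose zero x ∘ₚ transpose (suc zero) y′ , σx , transpose-right (suc zero) y′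
  where
  y′ : Fin (suc (suc m))
  y′ = Components.transpose zero x y
  y′≢0 : zero ≢ y′
  y′≢0 0≡y′ = x≢y (begin
    x                                                        ≡⟨ sym (transpose-right x zero) ⟩
    Components.transpose x zero zero                         ≡⟨ cong (Components.transpose x zero) 0≡y′ ⟩
    Components.transpose x zero (Components.transpose zero x y) ≡⟨ Components.transpose-inverse x zero ⟩
    y                                                        ∎)
  σx : Components.transpose (suc zero) y′ (Components.transpose zero x x) ≡ zero
  σx = trans (cong (Components.transpose (suc zero) y′) (transpose-right zero x))
             (transpose-other (suc zero) y′ (λ ()) y′≢0)

UniqueNonEdge⇒≅KminusE : ∀ {p} (H : Graph p) {x y} → UniqueNonEdge H x y → ∃[ m ] H ≅ KminusE m
UniqueNonEdge⇒≅KminusE {suc zero} H {zero} {zero} (x≢y , _) = ⊥-elim (x≢y refl)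
UniqueNonEdge⇒≅KminusE {suc (suc m)} H {x} {y} (x≢y , spec) = m , record
  { to        = σ ⟨$⟩ʳ_
  ; from      = σ ⟨$⟩ˡ_
  ; from∘to   = λ _ → inverseˡ σ
  ; to∘from   = λ _ → inverseʳ σ
  ; preserves = preserves
  }
  where
  σ : Permutation′ (suc (suc m))
  σ = proj₁ (permutation-to-01 x y x≢y)
  σx : σ ⟨$⟩ʳ x ≡ zero
  σx = proj₁ (proj₂ (permutation-to-01 x y x≢y))
  σy : σ ⟨$⟩ʳ y ≡ suc zero
  σy = proj₂ (proj₂ (permutation-to-01 x y x≢y))
  K-spec : ∀ i j → i ≢ j → adj (KminusE m) i j ≡ false ⇔ SamePair zero (suc zero) i j
  K-spec = proj₂ (UniqueNonEdge-KminusE m)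
  σ-injective : ∀ {i j} → σ ⟨$⟩ʳ i ≡ σ ⟨$⟩ʳ j → i ≡ j
  σ-injective {i} {j} e = trans (sym (inverseˡ σ)) (trans (cong (σ ⟨$⟩ˡ_) e) (inverseˡ σ))
  forth : ∀ {i j} → SamePair x y i j → SamePair zero (suc zero) (σ ⟨$⟩ʳ i) (σ ⟨$⟩ʳ j)
  forth {i} {j} p = subst₂ (λ a b → SamePair a b (σ ⟨$⟩ʳ i) (σ ⟨$⟩ʳ j)) σx σy (SamePair-map (σ ⟨$⟩ʳ_) p)
  back : ∀ {i j} → SamePair zero (suc zero) (σ ⟨$⟩ʳ i) (σ ⟨$⟩ʳ j) → SamePair x y i j
  back (inj₁ (σi≡0 , σj≡1)) = inj₁ (σ-injective (trans σi≡0 (sym σx)) , σ-injective (trans σj≡1 (sym σy)))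
  back (inj₂ (σi≡1 , σj≡0)) = inj₂ (σ-injective (trans σi≡1 (sym σy)) , σ-injective (trans σj≡0 (sym σx)))
  preserves : ∀ i j → adj H i j ≡ adj (KminusE m) (σ ⟨$⟩ʳ i) (σ ⟨$⟩ʳ j)
  preserves i j with i Fin.≟ j
  ... | yes refl = trans (adjIrr H i) (sym (adjIrr (KminusE m) (σ ⟨$⟩ʳ i)))
  ... | no  i≢j  = 𝔹.⇔→≡ (mk⇔
    (λ a → Equivalence.from (K-spec _ _ (i≢j ∘ σ-injective)) (forth (Equivalence.to (spec i j i≢j) a)))
    (λ a → Equivalence.from (spec i j i≢j) (back (Equivalence.to (K-spec _ _ (i≢j ∘ σ-injective)) a))))

-- Palindromic polynomials are f-symmetric

half-double : ∀ m → (m + m) / 2 ≡ m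
half-double m = trans (cong (_/ 2) (double m)) (m*n/n≡m m 2)
  where
  double : ∀ m → m + m ≡ m * 2
  double = solve-∀

Palindromic⇒fSymmetric : ∀ {t m g} → Palindromic t m g → fSymmetric g (m + m) (λ i → t ^ ((m + m) / 2 ∸ i))
Palindromic⇒fSymmetric {t} {m} {g} pal i i≤half = begin
  g (m + m ∸ i)                 ≡⟨ cong g (+-∸-assoc m i≤m) ⟩
  g (m + (m ∸ i))               ≡⟨ pal i (m ∸ i) (m+[n∸m]≡n i≤m) ⟩
  t ^ (m ∸ i) * g i             ≡⟨ cong (λ k → t ^ (k ∸ i) * g i) (sym (half-double m)) ⟩
  t ^ ((m + m) / 2 ∸ i) * g i   ∎
  where
  i≤m : i ≤ m
  i≤m = subst (i ≤_) (half-double m) i≤half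

Symmetric⇔base≡1 : ∀ {g N t} → fSymmetric g N (λ i → t ^ (N / 2 ∸ i)) → g 0 ≡ 1 → 1 ≤ N / 2 →
  Symmetric g N ⇔ t ≡ 1
Symmetric⇔base≡1 {g} {N} {t} fsym g0≡1 1≤N/2 = mk⇔ to from
  where
  to : Symmetric g N → t ≡ 1
  to symmetric = base≡1 (N / 2) 1≤N/2 (begin
    t ^ (N / 2)         ≡⟨ sym (*-identityʳ _) ⟩
    t ^ (N / 2) * 1     ≡⟨ cong (t ^ (N / 2) *_) (sym g0≡1) ⟩
    t ^ (N / 2) * g 0   ≡⟨ sym (fsym 0 z≤n) ⟩
    g N                 ≡⟨ symmetric 0 z≤n ⟩
    g 0                 ≡⟨ g0≡1 ⟩
    1                   ∎)
    where
    base≡1 : ∀ k → 1 ≤ k → t ^ k ≡ 1 → t ≡ 1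
    base≡1 (suc k) _ tᵏ⁺¹≡1 = m*n≡1⇒m≡1 t (t ^ k) tᵏ⁺¹≡1
  from : t ≡ 1 → Symmetric g N
  from refl i i≤ = trans (fsym i i≤) (trans (cong (_* g i) (^-zeroˡ (N / 2 ∸ i))) (*-identityˡ (g i)))

nonEdgeCount≡1⇔≅KminusE : ∀ {p} (H : Graph p) → nonEdgeCount H ≡ 1 ⇔ (∃[ m ] H ≅ KminusE m)
nonEdgeCount≡1⇔≅KminusE H = mk⇔
  (λ t≡1 → let (_ , _ , u) = Equivalence.to (nonEdgeCount≡1⇔ H) t≡1 in UniqueNonEdge⇒≅KminusE H u)
  (λ (m , I) → Equivalence.from (nonEdgeCount≡1⇔ H) (_ , _ , UniqueNonEdge-≅ I (UniqueNonEdge-KminusE m)))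

theorem2p3 : ∀ {n p} (G : Graph n) (H : Graph p) → 1 ≤ n → indepNumber H ≡ 2 →
    fSymmetric (indepCount (corona G H)) (indepNumber (corona G H))
      (λ i → (p * (p ∸ 1) / 2 ∸ edgeCount H) ^ (indepNumber (corona G H) / 2 ∸ i))
  × (Symmetric (indepCount (corona G H)) (indepNumber (corona G H))
      ⇔ Σ ℕ (λ m → H ≅ KminusE m))
theorem2p3 {n} G H 1≤n αH≡2 =
  subst (λ t → fSymmetric s α (λ i → t ^ (α / 2 ∸ i))) (sym (nonEdgeCount-formula H)) fsym ,
  nonEdgeCount≡1⇔≅KminusE H ⇔-∘ Symmetric⇔base≡1 fsym (indepCount-0 (corona G H)) 1≤α/2
  where
  s : ℕ → ℕ
  s = indepCount (corona G H)
  α : ℕ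
  α = indepNumber (corona G H)
  α≤2 : ∀ B → isIndependent H B ≡ true → size B ≤ 2
  α≤2 B ind = subst (size B ≤_) αH≡2 (size≤indepNumber H B ind)
  t≢0 : nonEdgeCount H ≢ 0
  t≢0 = subst (_≢ 0) (indepCount-2 H) (subst (λ k → indepCount H k ≢ 0) αH≡2 (indepCount-indepNumber≢0 H))
  α≡2n : α ≡ n + n
  α≡2n = indepNumber-corona H α≤2 G t≢0
  fsym : fSymmetric s α (λ i → nonEdgeCount H ^ (α / 2 ∸ i))
  fsym = subst (λ N → fSymmetric s N (λ i → nonEdgeCount H ^ (N / 2 ∸ i))) (sym α≡2n)
           (Palindromic⇒fSymmetric (corona-palindromic H α≤2 G))
  1≤α/2 : 1 ≤ α / 2
  1≤α/2 = subst (1 ≤_) (sym (trans (cong (_/ 2) α≡2n) (half-double n))) 1≤n
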